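{- Let $G$ be an $n$-vertex graph with at least one edge. Then for every non-negative integer $k$, \[z(G;k)\le \sum_{v\in V(G)} d(v)\binom{n-d(v)}{k-d(v)},\] where $d(v)$ is the degree of $v$ in $G$ and $\binom{a}{b}=0$ when $b<0$ or $b>a$.
   Context: All graphs are finite and simple. Zero forcing: given a graph $G$ whose vertices are each colored blue or white, if a blue vertex $u$ has exactly one white neighbor $v$, then $v$ may be recolored blue; this rule is applied repeatedly. A set $B\subseteq V(G)$ is a zero forcing set of $G$ if, starting with exactly the vertices of $B$ blue, repeated application eventually colors all of $V(G)$ blue. $z(G;k)$ denotes the number of zero forcing sets of $G$ of size exactly $k$. -}

module Defs where

open import Data.Nat using (ℕ; _≤ᵇ_; _∸_)
open import Data.Nat.Combinatorics using (_C_)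
open import Data.Bool using (Bool; true; false; if_then_else_)
open import Data.Fin using (Fin)
open import Data.Fin.Subset using (Subset; _∈_; ∣_∣)
open import Data.Vec using (tabulate)
open import Data.List using (List; map; allFin)
open import Data.Nat.ListAction using (sum)
open import Data.Product using (∃₂)
open import Relation.Binary.PropositionalEquality using (_≡_; _≢_)

record Graph (n : ℕ) : Set where
  field
    adj   : Fin n → Fin n → Bool
    sym   : ∀ u v → adj u v ≡ adj v u
    irref : ∀ v → adj v v ≡ false
open Graph public

HasEdge : ∀ {n} → Graph n → Set
HasEdge G = ∃₂ λ u v → adj G u v ≡ true

deg : ∀ {n} → Graph n → Fin n → ℕ
deg G v = ∣ tabulate (adj G v) ∣

-- Vertices eventually coloured blue when starting from B
-- (the closure under the zero-forcing colour-change rule):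
-- a blue vertex u forces its neighbour v if every other neighbour w ≠ v of u is blue.
data Blue {n : ℕ} (G : Graph n) (B : Subset n) : Fin n → Set where
  initial : ∀ {v} → v ∈ B → Blue G B v
  force   : ∀ {u v} → Blue G B u → adj G u v ≡ true →
            (∀ w → adj G u w ≡ true → w ≢ v → Blue G B w) →
            Blue G B v

IsZeroForcingSet : ∀ {n} → Graph n → Subset n → Set
IsZeroForcingSet G B = ∀ v → Blue G B v

-- binomial(a, b) with b = k - d an integer; 0 when b < 0 (d > k) or b > a
binomZ : ℕ → ℕ → ℕ → ℕ
binomZ a k d = if d ≤ᵇ k then a C (k ∸ d) else 0

bound : ∀ {n} → Graph n → ℕ → ℕ
bound {n} G k = sum (map (λ v → deg G v Data.Nat.* binomZ (n ∸ deg G v) k (deg G v)) (allFin n))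

-- If B is a zero forcing set, look at a force u → v performed at the very start
-- (one exists when G has an edge): then B contains the closed neighbourhood of u
-- minus v, a set of exactly d(u) vertices. So every zero forcing set of size k is
-- a k-superset of N[u] ∖ {v} for some edge uv, and there are d(u) choices of v and
-- C(n - d(u), k - d(u)) such supersets for each u.
module Submission where

open import Defs hiding (sym)
open import Data.Nat using (ℕ; zero; suc; pred; _+_; _*_; _∸_; _≤_; z≤n; s≤s)
open import Data.Nat.Properties using (+-suc; +-∸-assoc; suc-injective; module ≤-Reasoning)
open import Data.Nat.Combinatorics using (nCk+nC[k+1]≡[n+1]C[k+1])
open import Data.Nat.ListAction using (sum)
open import Data.Bool using (Bool; true; false; T?)
open import Data.Bool.Properties using (T-≡) renaming (_≟_ to _≟ᵇ_)
open import Data.Fin using (Fin; zero; suc; _≟_)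
open import Data.Fin.Properties using (any?; all?; ¬∀⟶∃¬)
open import Data.Fin.Subset using (Subset; inside; outside; _∈_; _∉_; _⊆_; ∣_∣)
open import Data.Fin.Subset.Properties using (∣p∣≤n; drop-∷-⊆; _∈?_)
open import Data.Vec using ([]; _∷_; here; there; lookup; _[_]≔_)
import Data.Vec as Vec
open import Data.Vec.Properties
  using (lookup∘tabulate; lookup∘update; lookup∘update′; []=⇒lookup; lookup⇒[]=)
open import Data.List using (List; []; _∷_; [_]; _++_; length; map; concatMap; filterᵇ; allFin)
import Data.List as List
open import Data.List.Properties using (length-++; length-map; map-cong)
open import Data.List.Membership.Propositional using (lose) renaming (_∈_ to _∈ₗ_)
open import Data.List.Membership.Propositional.Properties
  using (∈-∃++; ∈-++⁺ˡ; ∈-++⁺ʳ; ∈-++⁻; ∈-map⁺; ∈-concatMap⁺; ∈-filter⁺; ∈-filter⁻; ∈-allFin)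
open import Data.List.Relation.Binary.Subset.Propositional using () renaming (_⊆_ to _⊆ₗ_)
open import Data.List.Relation.Unary.All as All using (All)
open import Data.List.Relation.Unary.Any using (here; there)
open import Data.List.Relation.Unary.AllPairs using (_∷_)
open import Data.List.Relation.Unary.Unique.Propositional using (Unique)
open import Data.Product using (_×_; _,_; ∃₂; proj₂)
open import Data.Sum using (_⊎_; inj₁; inj₂)
open import Function using (_∘_; id)
open import Function.Bundles using (Equivalence)
open import Relation.Nullary using (Dec; yes; no; ¬?; contradiction)
open import Relation.Nullary.Decidable using (_×-dec_)
open import Relation.Binary.PropositionalEquality
  using (_≡_; _≢_; refl; sym; trans; cong; cong₂; module ≡-Reasoning)

private variable
  A B : Set
  n : ℕ

∈-++-∷⁻ : ∀ (ys : List A) {zs x y} → y ∈ₗ ys ++ x ∷ zs → y ≢ x → y ∈ₗ ys ++ zs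
∈-++-∷⁻ ys {zs} y∈ y≢x with ∈-++⁻ ys y∈
... | inj₁ y∈ys         = ∈-++⁺ˡ y∈ys
... | inj₂ (here y≡x)   = contradiction y≡x y≢x
... | inj₂ (there y∈zs) = ∈-++⁺ʳ ys y∈zs

Unique-⊆⇒length≤ : ∀ {xs ys : List A} → Unique xs → xs ⊆ₗ ys → length xs ≤ length ys
Unique-⊆⇒length≤ {xs = []} _ _ = z≤n
Unique-⊆⇒length≤ {xs = x ∷ xs} (x∉xs ∷ unique) xs⊆ys with ∈-∃++ (xs⊆ys (here refl))
... | ys₁ , ys₂ , refl = begin
  suc (length xs)               ≤⟨ s≤s (Unique-⊆⇒length≤ unique xs⊆ys₁++ys₂) ⟩
  suc (length (ys₁ ++ ys₂))     ≡⟨ cong suc (length-++ ys₁) ⟩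
  suc (length ys₁ + length ys₂) ≡⟨ sym (+-suc (length ys₁) (length ys₂)) ⟩
  length ys₁ + length (x ∷ ys₂) ≡⟨ sym (length-++ ys₁) ⟩
  length (ys₁ ++ x ∷ ys₂)       ∎
  where
  open ≤-Reasoning
  xs⊆ys₁++ys₂ : xs ⊆ₗ ys₁ ++ ys₂
  xs⊆ys₁++ys₂ y∈xs = ∈-++-∷⁻ ys₁ (xs⊆ys (there y∈xs)) (λ { refl → All.lookup x∉xs y∈xs refl })

length-concatMap : ∀ (f : A → List B) xs → length (concatMap f xs) ≡ sum (map (length ∘ f) xs)
length-concatMap f []       = refl
length-concatMap f (x ∷ xs) = trans (length-++ (f x)) (cong (length (f x) +_) (length-concatMap f xs))

length-concatMap-uniform : ∀ (f : A → List B) xs {c} → (∀ {x} → x ∈ₗ xs → length (f x) ≡ c) →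
                           length (concatMap f xs) ≡ length xs * c
length-concatMap-uniform f []       _       = refl
length-concatMap-uniform f (x ∷ xs) uniform = trans (length-++ (f x))
  (cong₂ _+_ (uniform (here refl)) (length-concatMap-uniform f xs (uniform ∘ there)))

length-filterᵇ-tabulate : ∀ (p : A → Bool) (f : Fin n → A) →
                          length (filterᵇ p (List.tabulate f)) ≡ ∣ Vec.tabulate (p ∘ f) ∣
length-filterᵇ-tabulate {n = zero}  p f = refl
length-filterᵇ-tabulate {n = suc n} p f with p (f zero)
... | true  = cong suc (length-filterᵇ-tabulate p (f ∘ suc))
... | false = length-filterᵇ-tabulate p (f ∘ suc)

binomZ-zero-suc : ∀ a d → binomZ a 0 d ≡ binomZ (suc a) 0 d
binomZ-zero-suc a zero    = refl
binomZ-zero-suc a (suc d) = refl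

binomZ-suc-suc : ∀ a k d → binomZ a (suc k) (suc d) ≡ binomZ a k d
binomZ-suc-suc a k zero    = refl
binomZ-suc-suc a k (suc d) = refl

binomZ-pascal : ∀ a k d → binomZ a k d + binomZ a (suc k) d ≡ binomZ (suc a) (suc k) d
binomZ-pascal a k       zero          = nCk+nC[k+1]≡[n+1]C[k+1] a k
binomZ-pascal a zero    (suc zero)    = refl
binomZ-pascal a zero    (suc (suc d)) = refl
binomZ-pascal a (suc k) (suc d)       = begin
  binomZ a (suc k) (suc d) + binomZ a (suc (suc k)) (suc d)
    ≡⟨ cong₂ _+_ (binomZ-suc-suc a k d) (binomZ-suc-suc a (suc k) d) ⟩
  binomZ a k d + binomZ a (suc k) d    ≡⟨ binomZ-pascal a k d ⟩
  binomZ (suc a) (suc k) d             ≡⟨ binomZ-suc-suc (suc a) (suc k) d ⟨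
  binomZ (suc a) (suc (suc k)) (suc d) ∎
  where open ≡-Reasoning

supersetsOfSize : Subset n → ℕ → List (Subset n)
supersetsOfSize []            zero    = [ [] ]
supersetsOfSize []            (suc k) = []
supersetsOfSize (inside  ∷ p) zero    = []
supersetsOfSize (inside  ∷ p) (suc k) = map (inside ∷_) (supersetsOfSize p k)
supersetsOfSize (outside ∷ p) zero    = map (outside ∷_) (supersetsOfSize p zero)
supersetsOfSize (outside ∷ p) (suc k) =
  map (inside ∷_) (supersetsOfSize p k) ++ map (outside ∷_) (supersetsOfSize p (suc k))

∈-supersetsOfSize : ∀ {p q : Subset n} {k} → p ⊆ q → ∣ q ∣ ≡ k → q ∈ₗ supersetsOfSize p k
∈-supersetsOfSize {p = []}          {[]}          {zero}  _   _  = here refl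
∈-supersetsOfSize {p = inside  ∷ p} {inside  ∷ q} {suc k} p⊆q eq =
  ∈-map⁺ (inside ∷_) (∈-supersetsOfSize (drop-∷-⊆ p⊆q) (cong pred eq))
∈-supersetsOfSize {p = inside  ∷ p} {outside ∷ q} p⊆q _ with p⊆q here
... | ()
∈-supersetsOfSize {p = outside ∷ p} {inside  ∷ q} {suc k} p⊆q eq =
  ∈-++⁺ˡ (∈-map⁺ (inside ∷_) (∈-supersetsOfSize (drop-∷-⊆ p⊆q) (cong pred eq)))
∈-supersetsOfSize {p = outside ∷ p} {outside ∷ q} {zero}  p⊆q eq =
  ∈-map⁺ (outside ∷_) (∈-supersetsOfSize (drop-∷-⊆ p⊆q) eq)
∈-supersetsOfSize {p = outside ∷ p} {outside ∷ q} {suc k} p⊆q eq =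
  ∈-++⁺ʳ _ (∈-map⁺ (outside ∷_) (∈-supersetsOfSize (drop-∷-⊆ p⊆q) eq))

length-supersetsOfSize : ∀ (p : Subset n) k →
                         length (supersetsOfSize p k) ≡ binomZ (n ∸ ∣ p ∣) k ∣ p ∣
length-supersetsOfSize []            zero    = refl
length-supersetsOfSize []            (suc k) = refl
length-supersetsOfSize (inside  ∷ p) zero    = refl
length-supersetsOfSize {suc n} (inside  ∷ p) (suc k) =
  trans (length-map _ (supersetsOfSize p k))
    (trans (length-supersetsOfSize p k) (sym (binomZ-suc-suc (n ∸ ∣ p ∣) k ∣ p ∣)))
length-supersetsOfSize {suc n} (outside ∷ p) k
  rewrite +-∸-assoc 1 (∣p∣≤n p) = extend k
  where
  a = n ∸ ∣ p ∣
  sup = supersetsOfSize p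
  IH : ∀ k → length (sup k) ≡ binomZ a k ∣ p ∣
  IH = length-supersetsOfSize p
  extend : ∀ k → length (supersetsOfSize (outside ∷ p) k) ≡ binomZ (suc a) k ∣ p ∣
  extend zero = begin
    length (map (outside ∷_) (sup zero)) ≡⟨ length-map _ (sup zero) ⟩
    length (sup zero)                    ≡⟨ IH zero ⟩
    binomZ a zero ∣ p ∣                  ≡⟨ binomZ-zero-suc a ∣ p ∣ ⟩
    binomZ (suc a) zero ∣ p ∣            ∎
    where open ≡-Reasoning
  extend (suc k) = begin
    length (map (inside ∷_) (sup k) ++ map (outside ∷_) (sup (suc k)))
      ≡⟨ length-++ (map (inside ∷_) (sup k)) ⟩
    length (map (inside ∷_) (sup k)) + length (map (outside ∷_) (sup (suc k)))
      ≡⟨ cong₂ _+_ (length-map _ (sup k)) (length-map _ (sup (suc k))) ⟩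
    length (sup k) + length (sup (suc k))
      ≡⟨ cong₂ _+_ (IH k) (IH (suc k)) ⟩
    binomZ a k ∣ p ∣ + binomZ a (suc k) ∣ p ∣
      ≡⟨ binomZ-pascal a k ∣ p ∣ ⟩
    binomZ (suc a) (suc k) ∣ p ∣ ∎
    where open ≡-Reasoning

x∉p⇒∣p[x]≔inside∣≡1+∣p∣ : ∀ {p : Subset n} {x} → x ∉ p → ∣ p [ x ]≔ inside ∣ ≡ suc ∣ p ∣
x∉p⇒∣p[x]≔inside∣≡1+∣p∣ {p = inside  ∷ p} {zero}  x∉p = contradiction here x∉p
x∉p⇒∣p[x]≔inside∣≡1+∣p∣ {p = outside ∷ p} {zero}  x∉p = refl
x∉p⇒∣p[x]≔inside∣≡1+∣p∣ {p = inside  ∷ p} {suc x} x∉p = cong suc (x∉p⇒∣p[x]≔inside∣≡1+∣p∣ (x∉p ∘ there))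
x∉p⇒∣p[x]≔inside∣≡1+∣p∣ {p = outside ∷ p} {suc x} x∉p = x∉p⇒∣p[x]≔inside∣≡1+∣p∣ (x∉p ∘ there)

x∈p⇒1+∣p[x]≔outside∣≡∣p∣ : ∀ {p : Subset n} {x} → x ∈ p → suc ∣ p [ x ]≔ outside ∣ ≡ ∣ p ∣
x∈p⇒1+∣p[x]≔outside∣≡∣p∣ here                        = refl
x∈p⇒1+∣p[x]≔outside∣≡∣p∣ {p = inside  ∷ p} (there x∈p) = cong suc (x∈p⇒1+∣p[x]≔outside∣≡∣p∣ x∈p)
x∈p⇒1+∣p[x]≔outside∣≡∣p∣ {p = outside ∷ p} (there x∈p) = x∈p⇒1+∣p[x]≔outside∣≡∣p∣ x∈p

module _ (G : Graph n) where

  neighbourhood : Fin n → Subset n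
  neighbourhood u = Vec.tabulate (adj G u)

  neighbours : Fin n → List (Fin n)
  neighbours u = filterᵇ (adj G u) (allFin n)

  closedNeighbourhoodWithout : Fin n → Fin n → Subset n
  closedNeighbourhoodWithout u v = neighbourhood u [ u ]≔ inside [ v ]≔ outside

  lookup-neighbourhood : ∀ u v → lookup (neighbourhood u) v ≡ adj G u v
  lookup-neighbourhood u v = lookup∘tabulate (adj G u) v

  length-neighbours : ∀ u → length (neighbours u) ≡ deg G u
  length-neighbours u = length-filterᵇ-tabulate (adj G u) id

  ∈-neighbours⁺ : ∀ {u v} → adj G u v ≡ true → v ∈ₗ neighbours u
  ∈-neighbours⁺ {u} {v} uv = ∈-filter⁺ (T? ∘ adj G u) (∈-allFin v) (Equivalence.from T-≡ uv)

  ∈-neighbours⁻ : ∀ {u v} → v ∈ₗ neighbours u → adj G u v ≡ true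
  ∈-neighbours⁻ {u} v∈ = Equivalence.to T-≡ (proj₂ (∈-filter⁻ (T? ∘ adj G u) {xs = allFin n} v∈))

  adj⇒≢ : ∀ {u v} → adj G u v ≡ true → v ≢ u
  adj⇒≢ {u} uv refl with trans (sym uv) (irref G u)
  ... | ()

  ∣closedNeighbourhoodWithout∣≡deg : ∀ {u v} → adj G u v ≡ true →
                                     ∣ closedNeighbourhoodWithout u v ∣ ≡ deg G u
  ∣closedNeighbourhoodWithout∣≡deg {u} {v} uv = suc-injective (begin
    suc ∣ neighbourhood u [ u ]≔ inside [ v ]≔ outside ∣ ≡⟨ x∈p⇒1+∣p[x]≔outside∣≡∣p∣ v∈N[u] ⟩
    ∣ neighbourhood u [ u ]≔ inside ∣                   ≡⟨ x∉p⇒∣p[x]≔inside∣≡1+∣p∣ u∉neighbourhood ⟩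
    suc ∣ neighbourhood u ∣                             ∎)
    where
    open ≡-Reasoning
    u∉neighbourhood : u ∉ neighbourhood u
    u∉neighbourhood u∈
      with trans (sym ([]=⇒lookup u∈)) (trans (lookup-neighbourhood u u) (irref G u))
    ... | ()
    v∈N[u] : v ∈ neighbourhood u [ u ]≔ inside
    v∈N[u] = lookup⇒[]= v _ (trans (lookup∘update′ (adj⇒≢ uv) (neighbourhood u) inside)
                                    (trans (lookup-neighbourhood u v) uv))

  InitialForce : Subset n → Fin n → Fin n → Set
  InitialForce B u v = u ∈ B × adj G u v ≡ true × (∀ w → adj G u w ≡ true → w ≢ v → w ∈ B)

  initialForce⇒closedNeighbourhoodWithout⊆ : ∀ {B u v} → InitialForce B u v →
                                             closedNeighbourhoodWithout u v ⊆ B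
  initialForce⇒closedNeighbourhoodWithout⊆ {B} {u} {v} (u∈B , _ , others∈B) {w} w∈ =
    member (w ≟ v) (w ≟ u) ([]=⇒lookup w∈)
    where
    member : Dec (w ≡ v) → Dec (w ≡ u) →
             lookup (closedNeighbourhoodWithout u v) w ≡ inside → w ∈ B
    member (yes refl) _          w∈
      with trans (sym (lookup∘update w (neighbourhood u [ u ]≔ inside) outside)) w∈
    ... | ()
    member (no w≢v)   (yes refl) _  = u∈B
    member (no w≢v)   (no w≢u)   w∈ = others∈B w (begin
      adj G u w                                ≡⟨ lookup-neighbourhood u w ⟨
      lookup (neighbourhood u) w               ≡⟨ lookup∘update′ w≢u (neighbourhood u) inside ⟨
      lookup (neighbourhood u [ u ]≔ inside) w ≡⟨ lookup∘update′ w≢v (neighbourhood u [ u ]≔ inside) outside ⟨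
      lookup (closedNeighbourhoodWithout u v) w ≡⟨ w∈ ⟩
      inside                                   ∎) w≢v
      where open ≡-Reasoning

  -- Induction on the derivation: if the source u of the last force lies in B, then
  -- either all its other neighbours lie in B too, or one of them is a blue vertex
  -- outside B with a smaller derivation.
  blue⇒∈⊎initialForce : ∀ {B x} → Blue G B x → x ∈ B ⊎ ∃₂ (InitialForce B)
  blue⇒∈⊎initialForce (initial x∈B) = inj₁ x∈B
  blue⇒∈⊎initialForce {B} (force {u} {x} blue-u ux others-blue)
    with blue⇒∈⊎initialForce blue-u
  ... | inj₂ start = inj₂ start
  ... | inj₁ u∈B with any? (λ w → (adj G u w ≟ᵇ true) ×-dec ¬? (w ≟ x) ×-dec ¬? (w ∈? B))
  ...   | no  none = inj₂ (u , x , u∈B , ux , others∈B)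
    where
    others∈B : ∀ w → adj G u w ≡ true → w ≢ x → w ∈ B
    others∈B w uw w≢x with w ∈? B
    ... | yes w∈B = w∈B
    ... | no  w∉B = contradiction (w , uw , w≢x , w∉B) none
  ...   | yes (w , uw , w≢x , w∉B) with blue⇒∈⊎initialForce (others-blue w uw w≢x)
  ...     | inj₁ w∈B    = contradiction w∈B w∉B
  ...     | inj₂ start = inj₂ start

  zeroForcingSet⇒initialForce : ∀ {B} → HasEdge G → IsZeroForcingSet G B → ∃₂ (InitialForce B)
  zeroForcingSet⇒initialForce {B} (u , v , uv) zfs with all? (_∈? B)
  ... | yes all∈B = u , v , all∈B u , uv , (λ w _ _ → all∈B w)
  ... | no ¬all∈B with ¬∀⟶∃¬ n (_∈ B) (_∈? B) ¬all∈B
  ...   | w , w∉B with blue⇒∈⊎initialForce (zfs w)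
  ...     | inj₁ w∈B    = contradiction w∈B w∉B
  ...     | inj₂ start = start

  candidates : ℕ → List (Subset n)
  candidates k = concatMap (λ u → concatMap (λ v → supersetsOfSize (closedNeighbourhoodWithout u v) k)
                                            (neighbours u))
                           (allFin n)

  ∈-candidates : ∀ {B u v k} → InitialForce B u v → ∣ B ∣ ≡ k → B ∈ₗ candidates k
  ∈-candidates {u = u} start@(_ , uv , _) ∣B∣≡k =
    ∈-concatMap⁺ _ (lose (∈-allFin u) (∈-concatMap⁺ _ (lose (∈-neighbours⁺ uv)
      (∈-supersetsOfSize (initialForce⇒closedNeighbourhoodWithout⊆ start) ∣B∣≡k))))

  length-candidates : ∀ k → length (candidates k) ≡ bound G k
  length-candidates k =
    trans (length-concatMap _ (allFin n)) (cong sum (map-cong length-per-vertex (allFin n)))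
    where
    length-per-vertex : ∀ u →
      length (concatMap (λ v → supersetsOfSize (closedNeighbourhoodWithout u v) k) (neighbours u))
        ≡ deg G u * binomZ (n ∸ deg G u) k (deg G u)
    length-per-vertex u = trans (length-concatMap-uniform _ (neighbours u) length-supersets)
                                (cong (_* binomZ (n ∸ deg G u) k (deg G u)) (length-neighbours u))
      where
      length-supersets : ∀ {v} → v ∈ₗ neighbours u →
        length (supersetsOfSize (closedNeighbourhoodWithout u v) k) ≡ binomZ (n ∸ deg G u) k (deg G u)
      length-supersets {v} v∈ rewrite sym (∣closedNeighbourhoodWithout∣≡deg (∈-neighbours⁻ v∈)) =
        length-supersetsOfSize (closedNeighbourhoodWithout u v) k

lemma3p4 : ∀ {n} (G : Graph n) → HasEdge G → (k : ℕ) →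
    (L : List (Subset n)) → Unique L →
    All (λ B → ∣ B ∣ ≡ k × IsZeroForcingSet G B) L →
    length L ≤ bound G k
lemma3p4 G hasEdge k L unique zeroForcing = begin
  length L                  ≤⟨ Unique-⊆⇒length≤ unique L⊆candidates ⟩
  length (candidates G k)   ≡⟨ length-candidates G k ⟩
  bound G k                 ∎
  where
  open ≤-Reasoning
  L⊆candidates : L ⊆ₗ candidates G k
  L⊆candidates B∈L with ∣B∣≡k , zfs ← All.lookup zeroForcing B∈L
                   with u , v , start ← zeroForcingSet⇒initialForce G hasEdge zfs
    = ∈-candidates G start ∣B∣≡k
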